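{- Let $G$ and $G'$ be balanced triangulations of a closed surface $F^2$ such that $G'$ is obtained from $G$ by applying the BE-subdivision to the edge $v_0v_1$ of $G$. Let $xv_0v_1$ and $yv_0v_1$ be the faces of $G$ containing $v_0v_1$, and let $u\neq v_0$ be the vertex such that $xv_1u$ is a face of $G$. If $uy$ is not an edge of $G$, then $G'$ is obtained from $G$ by a sequence of P-splittings.
   Context: A triangulation of a closed surface $F^2$ is a simple graph embedded on $F^2$ such that every face is bounded by a $3$-cycle and any two faces share at most one edge; it is balanced if its graph is $3$-colorable; a face on $a,b,c$ is written $abc$. Operations must produce again a triangulation (no multiple edges), and every triangle named is a face. BE-subdivision of an edge $sw$ contained in faces $asw$ and $bsw$: introduce new vertices $p$ (colored as $s$) and $q$ (colored as $w$), delete faces $asw,bsw$ and edge $sw$, and add faces $asq, apq, apw, bsq, bpq, bpw$. P-splitting: if a vertex $v$ lies in faces $vwx, vxy, vyz$ with $w,x,y,z$ distinct and $wz$ is not an edge, introduce a new vertex $u'$ (colored as $v$), delete these three faces and the edges $vx, vy$, and add the faces $vwz, u'wz, u'wx, u'xy, u'yz$. -}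

module Defs where

open import Data.Nat using (ℕ)
open import Data.Fin using (Fin)
open import Data.Product using (Σ; ∃; ∃-syntax; _×_; _,_)
open import Data.Sum using (_⊎_)
open import Data.List using (List; []; _∷_)
open import Data.List.Membership.Propositional using (_∈_)
open import Data.List.Relation.Unary.Any using (Any)
open import Data.List.Relation.Unary.AllPairs using (AllPairs)
open import Relation.Binary.PropositionalEquality using (_≡_; _≢_)
open import Relation.Binary.Construct.Closure.ReflexiveTransitive using (Star)
open import Relation.Nullary using (¬_)
open import Function.Bundles using (_⇔_)

-- Vertices are natural numbers; a (2-dimensional, pure) complex is given
-- by its list of triangular faces, each face a triple of vertices.
Tri : Set
Tri = ℕ × ℕ × ℕ

_≈T_ : Tri → Tri → Set
(a , b , c) ≈T t =
  (t ≡ (a , b , c)) ⊎ (t ≡ (a , c , b)) ⊎ (t ≡ (b , a , c)) ⊎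
  (t ≡ (b , c , a)) ⊎ (t ≡ (c , a , b)) ⊎ (t ≡ (c , b , a))

Complex : Set
Complex = List Tri

Face : Complex → ℕ → ℕ → ℕ → Set
Face K a b c = Any (λ t → t ≈T (a , b , c)) K

Edge : Complex → ℕ → ℕ → Set
Edge K a b = ∃[ c ] Face K a b c

Vertex : Complex → ℕ → Set
Vertex K v = ∃[ b ] ∃[ c ] Face K v b c

Distinct3 : Tri → Set
Distinct3 (a , b , c) = (a ≢ b) × (a ≢ c) × (b ≢ c)

-- Combinatorial triangulation of a closed (connected) surface:
-- nonempty pure simplicial 2-complex, no repeated faces, every edge in
-- exactly two faces, every vertex link connected (hence a cycle), and the
-- 1-skeleton connected.
record IsTriangulation (K : Complex) : Set where
  field
    nonempty    : K ≢ []
    nondegen    : ∀ {t} → t ∈ K → Distinct3 t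
    noRepeat    : AllPairs (λ t t' → ¬ (t ≈T t')) K
    edgeInTwo   : ∀ a b → Edge K a b →
                  ∃[ c ] ∃[ d ] (c ≢ d × Face K a b c × Face K a b d ×
                    (∀ e → Face K a b e → (e ≡ c) ⊎ (e ≡ d)))
    linkConn    : ∀ v w w' → Edge K v w → Edge K v w' →
                  Star (λ a b → Face K v a b) w w'
    connected   : ∀ a b → Vertex K a → Vertex K b → Star (Edge K) a b
open IsTriangulation public

Balanced : Complex → Set
Balanced K = Σ (ℕ → Fin 3) λ col → ∀ a b → Edge K a b → col a ≢ col b

FaceT : Complex → Tri → Set
FaceT K t = Any (λ s → s ≈T t) K

Replaces : Complex → List Tri → List Tri → Complex → Set
Replaces K removed added K' =
  ∀ t → FaceT K' t ⇔
        ((FaceT K t × ¬ Any (λ r → r ≈T t) removed) ⊎ Any (λ r → r ≈T t) added)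

BESubdivision : Complex → ℕ → ℕ → ℕ → ℕ → ℕ → ℕ → Complex → Set
BESubdivision K s w a b p q K' =
  a ≢ b × Face K a s w × Face K b s w ×
  ¬ Vertex K p × ¬ Vertex K q × p ≢ q ×
  Replaces K ((a , s , w) ∷ (b , s , w) ∷ [])
             ((a , s , q) ∷ (a , p , q) ∷ (a , p , w) ∷
              (b , s , q) ∷ (b , p , q) ∷ (b , p , w) ∷ []) K'

PSplitting : Complex → Complex → Set
PSplitting K K' =
  ∃[ v ] ∃[ w ] ∃[ x ] ∃[ y ] ∃[ z ] ∃[ u' ]
    (Face K v w x × Face K v x y × Face K v y z ×
     (w ≢ x) × (w ≢ y) × (w ≢ z) × (x ≢ y) × (x ≢ z) × (y ≢ z) ×
     ¬ Edge K w z × ¬ Vertex K u' ×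
     Replaces K ((v , w , x) ∷ (v , x , y) ∷ (v , y , z) ∷ [])
                ((v , w , z) ∷ (u' , w , z) ∷ (u' , w , x) ∷
                 (u' , x , y) ∷ (u' , y , z) ∷ []) K' ×
     IsTriangulation K')

PSplittings : Complex → Complex → Set
PSplittings = Star PSplitting

module Submission where

-- Under the hypotheses of Lemma 4.2 the BE-subdivision of v₀v₁ is the
-- composite of two P-splittings: first at v₁ along the faces v₁ux, v₁xv₀,
-- v₁v₀y (possible since uy is not an edge) with new vertex q, then at u
-- along the faces uv₁y, uyq, uqx with new vertex p (possible since v₁x is
-- no longer an edge).  A P-splitting step must produce a triangulation;
-- for the second step this is the hypothesis on G', for the first it is
-- the bulk of the proof.

open import Defs
open import Data.Nat using (ℕ; _≟_)
open import Data.Fin using (Fin)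
import Data.Fin.Properties as Fin
open import Data.Product using (∃; ∃-syntax; _×_; _,_; proj₁; proj₂)
open import Data.Product.Properties using (≡-dec)
open import Data.Sum using (_⊎_; inj₁; inj₂)
open import Data.List using (List; []; _∷_; _++_; filter)
open import Data.List.Properties using (++-conicalˡ)
open import Data.List.Membership.Propositional using (_∈_; find; lose)
open import Data.List.Membership.Propositional.Properties using (∈-filter⁺; ∈-filter⁻)
open import Data.List.Relation.Unary.Any as Any using (Any; here; there; any?)
import Data.List.Relation.Unary.Any.Properties as AnyP
open import Data.List.Relation.Unary.All as All using (All; []; _∷_)
import Data.List.Relation.Unary.All.Properties as AllP
open import Data.List.Relation.Unary.AllPairs using (AllPairs; []; _∷_)
import Data.List.Relation.Unary.AllPairs.Properties as AllPairsP
open import Data.Empty using (⊥; ⊥-elim)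
open import Relation.Binary.PropositionalEquality using (_≡_; _≢_; refl; sym; trans; cong; subst; ≢-sym)
open import Relation.Nullary using (¬_; Dec; yes; no; ¬?)
open import Relation.Nullary.Decidable using (_⊎-dec_; _×-dec_; from-yes)
open import Relation.Binary.Construct.Closure.ReflexiveTransitive
  using (Star; ε; _◅_; _◅◅_; return; reverse; kleisliStar)
open import Function.Bundles using (mk⇔; Equivalence)

-- The six presentations of one triangle.  'πijk' witnesses that the
-- triple (a , b , c) presents the same triangle as its rearrangement
-- whose entries are the i-th, j-th and k-th entries of (a , b , c).
pattern π123 = inj₁ refl
pattern π132 = inj₂ (inj₁ refl)
pattern π213 = inj₂ (inj₂ (inj₁ refl))
pattern π231 = inj₂ (inj₂ (inj₂ (inj₁ refl)))
pattern π312 = inj₂ (inj₂ (inj₂ (inj₂ (inj₁ refl))))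
pattern π321 = inj₂ (inj₂ (inj₂ (inj₂ (inj₂ refl))))

pattern #0 p = here p
pattern #1 p = there (here p)
pattern #2 p = there (there (here p))
pattern #3 p = there (there (there (here p)))
pattern #4 p = there (there (there (there (here p))))
pattern #5 p = there (there (there (there (there (here p)))))

-- _≈T_ is an equivalence relation: the permutation group S₃ is closed
-- under inverses and composition (the composition table below).
≈-sym : ∀ {s t} → s ≈T t → t ≈T s
≈-sym {a , b , c} π123 = π123
≈-sym {a , b , c} π132 = π132
≈-sym {a , b , c} π213 = π213
≈-sym {a , b , c} π231 = π312
≈-sym {a , b , c} π312 = π231
≈-sym {a , b , c} π321 = π321

≈-trans : ∀ {r s t} → r ≈T s → s ≈T t → r ≈T t
≈-trans {a , b , c} π123 π123 = π123
≈-trans {a , b , c} π123 π132 = π132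
≈-trans {a , b , c} π123 π213 = π213
≈-trans {a , b , c} π123 π231 = π231
≈-trans {a , b , c} π123 π312 = π312
≈-trans {a , b , c} π123 π321 = π321
≈-trans {a , b , c} π132 π123 = π132
≈-trans {a , b , c} π132 π132 = π123
≈-trans {a , b , c} π132 π213 = π312
≈-trans {a , b , c} π132 π231 = π321
≈-trans {a , b , c} π132 π312 = π213
≈-trans {a , b , c} π132 π321 = π231
≈-trans {a , b , c} π213 π123 = π213
≈-trans {a , b , c} π213 π132 = π231
≈-trans {a , b , c} π213 π213 = π123
≈-trans {a , b , c} π213 π231 = π132
≈-trans {a , b , c} π213 π312 = π321
≈-trans {a , b , c} π213 π321 = π312
≈-trans {a , b , c} π231 π123 = π231
≈-trans {a , b , c} π231 π132 = π213
≈-trans {a , b , c} π231 π213 = π321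
≈-trans {a , b , c} π231 π231 = π312
≈-trans {a , b , c} π231 π312 = π123
≈-trans {a , b , c} π231 π321 = π132
≈-trans {a , b , c} π312 π123 = π312
≈-trans {a , b , c} π312 π132 = π321
≈-trans {a , b , c} π312 π213 = π132
≈-trans {a , b , c} π312 π231 = π123
≈-trans {a , b , c} π312 π312 = π231
≈-trans {a , b , c} π312 π321 = π213
≈-trans {a , b , c} π321 π123 = π321
≈-trans {a , b , c} π321 π132 = π312
≈-trans {a , b , c} π321 π213 = π231
≈-trans {a , b , c} π321 π231 = π213
≈-trans {a , b , c} π321 π312 = π132
≈-trans {a , b , c} π321 π321 = π123

_≟T_ : (s t : Tri) → Dec (s ≡ t)
_≟T_ = ≡-dec _≟_ (≡-dec _≟_ _≟_)

_≈?_ : (s t : Tri) → Dec (s ≈T t)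
(a , b , c) ≈? t =
  (t ≟T (a , b , c)) ⊎-dec (t ≟T (a , c , b)) ⊎-dec (t ≟T (b , a , c)) ⊎-dec
  (t ≟T (b , c , a)) ⊎-dec (t ≟T (c , a , b)) ⊎-dec (t ≟T (c , b , a))

FaceT? : (K : Complex) (t : Tri) → Dec (FaceT K t)
FaceT? K t = any? (_≈? t) K

FaceT-≈ : ∀ {K t t'} → t ≈T t' → FaceT K t → FaceT K t'
FaceT-≈ e = Any.map (λ p → ≈-trans p e)

-- Rearranging the vertices of a face ('fijk' as for 'πijk').
module _ {K : Complex} {a b c : ℕ} where
  f132 : Face K a b c → Face K a c b
  f132 = FaceT-≈ π132
  f213 : Face K a b c → Face K b a c
  f213 = FaceT-≈ π213
  f231 : Face K a b c → Face K b c a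
  f231 = FaceT-≈ π231
  f312 : Face K a b c → Face K c a b
  f312 = FaceT-≈ π312
  f321 : Face K a b c → Face K c b a
  f321 = FaceT-≈ π321

_∈3_ : ℕ → Tri → Set
n ∈3 (a , b , c) = (n ≡ a) ⊎ (n ≡ b) ⊎ (n ≡ c)

pattern 1st = inj₁ refl
pattern 2nd = inj₂ (inj₁ refl)
pattern 3rd = inj₂ (inj₂ refl)

∉3 : ∀ {n a b c} → n ≢ a → n ≢ b → n ≢ c → ¬ (n ∈3 (a , b , c))
∉3 n≢a n≢b n≢c (inj₁ e) = n≢a e
∉3 n≢a n≢b n≢c (inj₂ (inj₁ e)) = n≢b e
∉3 n≢a n≢b n≢c (inj₂ (inj₂ e)) = n≢c e

vertices : ∀ {r a b c} → r ≈T (a , b , c) → (a ∈3 r) × (b ∈3 r) × (c ∈3 r)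
vertices {r₁ , r₂ , r₃} π123 = 1st , 2nd , 3rd
vertices {r₁ , r₂ , r₃} π132 = 1st , 3rd , 2nd
vertices {r₁ , r₂ , r₃} π213 = 2nd , 1st , 3rd
vertices {r₁ , r₂ , r₃} π231 = 2nd , 3rd , 1st
vertices {r₁ , r₂ , r₃} π312 = 3rd , 1st , 2nd
vertices {r₁ , r₂ , r₃} π321 = 3rd , 2nd , 1st

absent₁ : ∀ {r a b c} → ¬ (a ∈3 r) → ¬ (r ≈T (a , b , c))
absent₁ a∉r p = a∉r (proj₁ (vertices p))

absent₂ : ∀ {r a b c} → ¬ (b ∈3 r) → ¬ (r ≈T (a , b , c))
absent₂ b∉r p = b∉r (proj₁ (proj₂ (vertices p)))

absent₃ : ∀ {r a b c} → ¬ (c ∈3 r) → ¬ (r ≈T (a , b , c))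
absent₃ c∉r p = c∉r (proj₂ (proj₂ (vertices p)))

distinct-≈ : ∀ {r t} → Distinct3 r → r ≈T t → Distinct3 t
distinct-≈ {a , b , c} (a≢b , a≢c , b≢c) π123 = a≢b , a≢c , b≢c
distinct-≈ {a , b , c} (a≢b , a≢c , b≢c) π132 = a≢c , a≢b , ≢-sym b≢c
distinct-≈ {a , b , c} (a≢b , a≢c , b≢c) π213 = ≢-sym a≢b , b≢c , a≢c
distinct-≈ {a , b , c} (a≢b , a≢c , b≢c) π231 = b≢c , ≢-sym a≢b , ≢-sym a≢c
distinct-≈ {a , b , c} (a≢b , a≢c , b≢c) π312 = ≢-sym a≢c , ≢-sym b≢c , a≢b
distinct-≈ {a , b , c} (a≢b , a≢c , b≢c) π321 = ≢-sym b≢c , ≢-sym a≢c , ≢-sym a≢b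

orient₁ : ∀ {r₁ r₂ r₃ a b} → Distinct3 (r₁ , r₂ , r₃) → (r₁ , r₂ , r₃) ≈T (r₁ , a , b) →
          (a ≡ r₂ × b ≡ r₃) ⊎ (a ≡ r₃ × b ≡ r₂)
orient₁ d π123 = inj₁ (refl , refl)
orient₁ d π132 = inj₂ (refl , refl)
orient₁ d π213 = ⊥-elim (proj₁ d refl)
orient₁ d π231 = ⊥-elim (proj₁ d refl)
orient₁ d π312 = ⊥-elim (proj₁ (proj₂ d) refl)
orient₁ d π321 = ⊥-elim (proj₁ (proj₂ d) refl)

orient₂ : ∀ {r₁ r₂ r₃ a b} → Distinct3 (r₁ , r₂ , r₃) → (r₁ , r₂ , r₃) ≈T (r₂ , a , b) →
          (a ≡ r₁ × b ≡ r₃) ⊎ (a ≡ r₃ × b ≡ r₁)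
orient₂ d π123 = ⊥-elim (proj₁ d refl)
orient₂ d π132 = ⊥-elim (proj₁ d refl)
orient₂ d π213 = inj₁ (refl , refl)
orient₂ d π231 = inj₂ (refl , refl)
orient₂ d π312 = ⊥-elim (proj₂ (proj₂ d) refl)
orient₂ d π321 = ⊥-elim (proj₂ (proj₂ d) refl)

orient₃ : ∀ {r₁ r₂ r₃ a b} → Distinct3 (r₁ , r₂ , r₃) → (r₁ , r₂ , r₃) ≈T (r₃ , a , b) →
          (a ≡ r₁ × b ≡ r₂) ⊎ (a ≡ r₂ × b ≡ r₁)
orient₃ d π123 = ⊥-elim (proj₁ (proj₂ d) refl)
orient₃ d π132 = ⊥-elim (proj₁ (proj₂ d) refl)
orient₃ d π213 = ⊥-elim (proj₂ (proj₂ d) refl)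
orient₃ d π231 = ⊥-elim (proj₂ (proj₂ d) refl)
orient₃ d π312 = inj₁ (refl , refl)
orient₃ d π321 = inj₂ (refl , refl)

completes₁ : ∀ {r₁ r₂ r₃ e} → Distinct3 (r₁ , r₂ , r₃) → (r₁ , r₂ , r₃) ≈T (r₂ , r₃ , e) → e ≡ r₁
completes₁ d p with orient₂ d p
... | inj₁ (r₃≡r₁ , _) = ⊥-elim (proj₁ (proj₂ d) (sym r₃≡r₁))
... | inj₂ (_ , e≡r₁) = e≡r₁

completes₂ : ∀ {r₁ r₂ r₃ e} → Distinct3 (r₁ , r₂ , r₃) → (r₁ , r₂ , r₃) ≈T (r₁ , r₃ , e) → e ≡ r₂
completes₂ d p with orient₁ d p
... | inj₁ (r₃≡r₂ , _) = ⊥-elim (proj₂ (proj₂ d) (sym r₃≡r₂))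
... | inj₂ (_ , e≡r₂) = e≡r₂

completes₃ : ∀ {r₁ r₂ r₃ e} → Distinct3 (r₁ , r₂ , r₃) → (r₁ , r₂ , r₃) ≈T (r₁ , r₂ , e) → e ≡ r₃
completes₃ d p with orient₁ d p
... | inj₁ (_ , e≡r₃) = e≡r₃
... | inj₂ (r₂≡r₃ , _) = ⊥-elim (proj₂ (proj₂ d) r₂≡r₃)

OnVertices : (ℕ → Set) → Tri → Set
OnVertices P (a , b , c) = P a × P b × P c

OnEdges : (ℕ → ℕ → Set) → Tri → Set
OnEdges P (a , b , c) = P a b × P b c × P a c

onVertex : ∀ {P : ℕ → Set} {r n} → OnVertices P r → n ∈3 r → P n
onVertex (pa , pb , pc) 1st = pa
onVertex (pa , pb , pc) 2nd = pb
onVertex (pa , pb , pc) 3rd = pc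

onEdge : ∀ {P : ℕ → ℕ → Set} →
         (∀ {a} → P a a) → (∀ {a b} → P a b → P b a) →
         ∀ {r a b} → OnEdges P r → a ∈3 r → b ∈3 r → P a b
onEdge rfl sy (pab , pbc , pac) 1st 1st = rfl
onEdge rfl sy (pab , pbc , pac) 1st 2nd = pab
onEdge rfl sy (pab , pbc , pac) 1st 3rd = pac
onEdge rfl sy (pab , pbc , pac) 2nd 1st = sy pab
onEdge rfl sy (pab , pbc , pac) 2nd 2nd = rfl
onEdge rfl sy (pab , pbc , pac) 2nd 3rd = pbc
onEdge rfl sy (pab , pbc , pac) 3rd 1st = sy pac
onEdge rfl sy (pab , pbc , pac) 3rd 2nd = sy pbc
onEdge rfl sy (pab , pbc , pac) 3rd 3rd = rfl

first : ∀ {r a b c} → r ≈T (a , b , c) → a ∈3 r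
first p = proj₁ (vertices p)

firstTwo : ∀ {r a b c} → r ≈T (a , b , c) → (a ∈3 r) × (b ∈3 r)
firstTwo p = proj₁ (vertices p) , proj₁ (proj₂ (vertices p))

atSome : ∀ {L : List Tri} {P Q : Tri → Set} {B : Set} → All P L → Any Q L →
         (∀ {r} → P r → Q r → B) → B
atSome ps q use with All.lookupAny ps q
... | p , q' = use p q'

redirect : ℕ → ℕ → ℕ → ℕ
redirect s t n with n ≟ s
... | yes _ = t
... | no _ = n

redirect-hit : ∀ s t → redirect s t s ≡ t
redirect-hit s t with s ≟ s
... | yes _ = refl
... | no s≢s = ⊥-elim (s≢s refl)

redirect-miss : ∀ {s t n} → n ≢ s → redirect s t n ≡ n
redirect-miss {s} {t} {n} n≢s with n ≟ s
... | yes n≡s = ⊥-elim (n≢s n≡s)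
... | no _ = refl

distinctFace : ∀ {K a b c} → (∀ {t} → t ∈ K → Distinct3 t) → Face K a b c → Distinct3 (a , b , c)
distinctFace nd f with find f
... | s , s∈K , s≈abc = distinct-≈ (nd s∈K) s≈abc

faceDistinct : ∀ {K a b c} → IsTriangulation K → Face K a b c → Distinct3 (a , b , c)
faceDistinct T = distinctFace (nondegen T)

edgeSym : ∀ {K a b} → Edge K a b → Edge K b a
edgeSym (c , f) = c , f213 f

otherFace : ∀ {K a b c} → IsTriangulation K → Face K a b c →
            ∃[ d ] (d ≢ c × Face K a b d × (∀ e → Face K a b e → (e ≡ c) ⊎ (e ≡ d)))
otherFace {K} {a} {b} {c} T f with edgeInTwo T a b (c , f)
... | c' , d' , c'≢d' , fc' , fd' , only with only c f
...   | inj₁ refl = d' , ≢-sym c'≢d' , fd' , only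
...   | inj₂ refl = c' , c'≢d' , fc' , λ e fe → swap (only e fe)
  where
  swap : ∀ {e} → (e ≡ c') ⊎ (e ≡ c) → (e ≡ c) ⊎ (e ≡ c')
  swap (inj₁ e≡c') = inj₂ e≡c'
  swap (inj₂ e≡c) = inj₁ e≡c

onlyFaces : ∀ {K a b c d e} → IsTriangulation K → Face K a b c → Face K a b d → c ≢ d →
            Face K a b e → (e ≡ c) ⊎ (e ≡ d)
onlyFaces {e = e} T fc fd c≢d fe with otherFace T fc
... | d' , _ , _ , only with only _ fd | only e fe
...   | inj₁ d≡c | _ = ⊥-elim (c≢d (sym d≡c))
...   | inj₂ _ | inj₁ e≡c = inj₁ e≡c
...   | inj₂ d≡d' | inj₂ e≡d' = inj₂ (trans e≡d' (sym d≡d'))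

-- Three colours admit no four pairwise distinct values (an exhaustive
-- check of all 3⁴ assignments), so a balanced complex contains no K₄.
FourDistinct : (a b c d : Fin 3) → Set
FourDistinct a b c d = a ≢ b × a ≢ c × a ≢ d × b ≢ c × b ≢ d × c ≢ d

noFourColours : ∀ a b c d → ¬ FourDistinct a b c d
noFourColours =
  from-yes (Fin.all? λ a → Fin.all? λ b → Fin.all? λ c → Fin.all? λ d →
            ¬? (fourDistinct? a b c d))
  where
  fourDistinct? : ∀ a b c d → Dec (FourDistinct a b c d)
  fourDistinct? a b c d = ¬? (a Fin.≟ b) ×-dec ¬? (a Fin.≟ c) ×-dec ¬? (a Fin.≟ d) ×-dec
                          ¬? (b Fin.≟ c) ×-dec ¬? (b Fin.≟ d) ×-dec ¬? (c Fin.≟ d)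

noK₄ : ∀ {K a b c d} → Balanced K →
       Edge K a b → Edge K a c → Edge K a d → Edge K b c → Edge K b d → Edge K c d → ⊥
noK₄ {a = a} {b} {c} {d} (col , proper) ab ac ad bc bd cd =
  noFourColours (col a) (col b) (col c) (col d)
    (proper _ _ ab , proper _ _ ac , proper _ _ ad , proper _ _ bc , proper _ _ bd , proper _ _ cd)

kept? : (R : List Tri) (s : Tri) → Dec (¬ FaceT R s)
kept? R s = ¬? (FaceT? R s)

-- The replacement is kept opaque: it is used only through the
-- characterisations proved in this block.
opaque
  replace : Complex → List Tri → List Tri → Complex
  replace K R A = A ++ filter (kept? R) K

  replace⁻ : ∀ {K R A t} → FaceT (replace K R A) t → (FaceT K t × ¬ FaceT R t) ⊎ FaceT A t
  replace⁻ {R = R} {A} f with AnyP.++⁻ A f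
  ... | inj₁ fA = inj₂ fA
  ... | inj₂ fK with find fK
  ...   | s , s∈ , s≈t with ∈-filter⁻ (kept? R) s∈
  ...     | s∈K , s∉R = inj₁ (lose s∈K s≈t , λ fR → s∉R (FaceT-≈ (≈-sym s≈t) fR))

  replace⁺ : ∀ {K R A t} → (FaceT K t × ¬ FaceT R t) ⊎ FaceT A t → FaceT (replace K R A) t
  replace⁺ (inj₂ fA) = AnyP.++⁺ˡ fA
  replace⁺ {R = R} {A} (inj₁ (fK , t∉R)) with find fK
  ... | s , s∈K , s≈t =
    AnyP.++⁺ʳ A (lose (∈-filter⁺ (kept? R) s∈K λ fR → t∉R (FaceT-≈ s≈t fR)) s≈t)

  replace-nonempty : ∀ {K R A} → A ≢ [] → replace K R A ≢ []
  replace-nonempty {A = A} A≢[] KRA≡[] = A≢[] (++-conicalˡ A _ KRA≡[])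

  replace-∈ : ∀ {K R A t} → t ∈ replace K R A → t ∈ A ⊎ t ∈ K
  replace-∈ {R = R} {A} t∈ with AnyP.++⁻ A t∈
  ... | inj₁ t∈A = inj₁ t∈A
  ... | inj₂ t∈F = inj₂ (proj₁ (∈-filter⁻ (kept? R) t∈F))

  replace-noRepeat : ∀ {K R A} →
                     AllPairs (λ t t' → ¬ (t ≈T t')) K → AllPairs (λ t t' → ¬ (t ≈T t')) A →
                     All (λ a → ¬ FaceT K a) A → AllPairs (λ t t' → ¬ (t ≈T t')) (replace K R A)
  replace-noRepeat {R = R} distinctK distinctA new =
    AllPairsP.++⁺ distinctA (AllPairsP.filter⁺ (kept? R) distinctK)
                  (All.map (λ a∉K → AllP.filter⁺ (kept? R) (All.tabulate λ s∈K a≈s →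
                                       a∉K (lose s∈K (≈-sym a≈s)))) new)

module _ {K R A : List Tri} where

  replaces : Replaces K R A (replace K R A)
  replaces t = mk⇔ replace⁻ replace⁺

  replacedVertex : ∀ {a} → Vertex (replace K R A) a → Vertex K a ⊎ Any (a ∈3_) A
  replacedVertex (b , c , f) with replace⁻ {K} {R} {A} f
  ... | inj₁ (fK , _) = inj₁ (b , c , fK)
  ... | inj₂ fA = inj₂ (Any.map first fA)

-- Whether a triangulation survives a replacement is decided locally,
-- near the triangles R and A.
module Replacement (K : Complex) (tK : IsTriangulation K) (R A : List Tri)
                   (distinctA : All Distinct3 A) where

  K′ : Complex
  K′ = replace K R A

  origin : ∀ {t} → FaceT K′ t → (FaceT K t × ¬ FaceT R t) ⊎ FaceT A t
  origin = replace⁻ {K} {R} {A}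

  kept : ∀ {a b c} → Face K a b c → ¬ FaceT R (a , b , c) → Face K′ a b c
  kept f ∉R = replace⁺ {K} {R} {A} (inj₁ (f , ∉R))

  added : ∀ {a b c} → FaceT A (a , b , c) → Face K′ a b c
  added fA = replace⁺ {K} {R} {A} (inj₂ fA)

  nondegen′ : ∀ {t} → t ∈ K′ → Distinct3 t
  nondegen′ t∈K′ with replace-∈ {K} {R} {A} t∈K′
  ... | inj₁ t∈A = All.lookup distinctA t∈A
  ... | inj₂ t∈K = nondegen tK t∈K

  TwoFaces : ℕ → ℕ → Set
  TwoFaces a b = ∃[ c ] ∃[ d ] (c ≢ d × Face K′ a b c × Face K′ a b d ×
                   (∀ e → Face K′ a b e → (e ≡ c) ⊎ (e ≡ d)))

  twoFaces-sym : ∀ {a b} → TwoFaces a b → TwoFaces b a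
  twoFaces-sym (c , d , c≢d , fc , fd , only) =
    c , d , c≢d , f213 fc , f213 fd , λ e fe → only e (f213 fe)

  swappedEdge : ∀ {a b c c'} → Face K a b c → FaceT R (a , b , c) → FaceT A (a , b , c') →
                ¬ Face K a b c' → (∀ e → FaceT R (a , b , e) → e ≡ c) →
                (∀ e → FaceT A (a , b , e) → e ≡ c') → TwoFaces a b
  swappedEdge {a} {b} {c} {c'} fc c∈R c'∈A c'∉K onlyR onlyA with otherFace tK fc
  ... | d , d≢c , fd , onlyK =
    c' , d , (λ { refl → c'∉K fd }) , added c'∈A , kept fd (λ d∈R → d≢c (onlyR d d∈R)) , only
    where
    only : ∀ e → Face K′ a b e → (e ≡ c') ⊎ (e ≡ d)
    only e fe with origin fe
    ... | inj₂ e∈A = inj₁ (onlyA e e∈A)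
    ... | inj₁ (feK , e∉R) with onlyK e feK
    ...   | inj₁ refl = ⊥-elim (e∉R c∈R)
    ...   | inj₂ e≡d = inj₂ e≡d

  newEdge : ∀ {a b c d} → FaceT A (a , b , c) → FaceT A (a , b , d) → c ≢ d →
            ¬ Edge K a b → (∀ e → FaceT A (a , b , e) → (e ≡ c) ⊎ (e ≡ d)) → TwoFaces a b
  newEdge {a} {b} c∈A d∈A c≢d ab∉K onlyA = _ , _ , c≢d , added c∈A , added d∈A , only
    where
    only : ∀ e → Face K′ a b e → _
    only e fe with origin fe
    ... | inj₁ (feK , _) = ⊥-elim (ab∉K (e , feK))
    ... | inj₂ e∈A = onlyA e e∈A

  deletedEdge : ∀ {a b} → (∀ e → Face K a b e → FaceT R (a , b , e)) →
                (∀ e → ¬ FaceT A (a , b , e)) → ¬ Edge K′ a b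
  deletedEdge allR noneA (e , fe) with origin fe
  ... | inj₁ (feK , e∉R) = e∉R (allR e feK)
  ... | inj₂ e∈A = noneA e e∈A

  ∈3? : ∀ n r → Dec (n ∈3 r)
  ∈3? n (a , b , c) = (n ≟ a) ⊎-dec (n ≟ b) ⊎-dec (n ≟ c)

  Touched₂ : ℕ → ℕ → Set
  Touched₂ a b = Any (λ r → (a ∈3 r) × (b ∈3 r)) (R ++ A)

  Touched : ℕ → Set
  Touched a = Any (a ∈3_) (R ++ A)

  touchedR : ∀ {a b c} → FaceT R (a , b , c) → Touched₂ a b
  touchedR fR = AnyP.++⁺ˡ (Any.map firstTwo fR)

  touchedA : ∀ {a b c} → FaceT A (a , b , c) → Touched₂ a b
  touchedA fA = AnyP.++⁺ʳ R (Any.map firstTwo fA)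

  awayFace : ∀ {a b e} → ¬ Touched₂ a b → Face K′ a b e → Face K a b e
  awayFace away fe with origin fe
  ... | inj₁ (feK , _) = feK
  ... | inj₂ e∈A = ⊥-elim (away (touchedA e∈A))

  awayEdge : ∀ {a b} → ¬ Touched₂ a b → Edge K′ a b → TwoFaces a b
  awayEdge {a} {b} away (c , fc) with edgeInTwo tK a b (c , awayFace away fc)
  ... | c' , d' , c'≢d' , fc' , fd' , only =
    c' , d' , c'≢d' , keep fc' , keep fd' , λ e fe → only e (awayFace away fe)
    where
    keep : ∀ {e} → Face K a b e → Face K′ a b e
    keep fe = kept fe (λ e∈R → away (touchedR e∈R))

  EdgeOK : ℕ → ℕ → Set
  EdgeOK a b = Edge K′ a b → TwoFaces a b

  noLoop : ∀ {a} → ¬ Edge K′ a a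
  noLoop (c , f) = proj₁ (distinctFace nondegen′ f) refl

  edgeInTwo′ : All (OnEdges EdgeOK) (R ++ A) → ∀ a b → EdgeOK a b
  edgeInTwo′ local a b with any? (λ r → ∈3? a r ×-dec ∈3? b r) (R ++ A)
  ... | no away = awayEdge away
  ... | yes near = atSome local near λ ok (a∈r , b∈r) →
          onEdge (λ e → ⊥-elim (noLoop e)) (λ ok e → twoFaces-sym (ok (edgeSym e))) ok a∈r b∈r

  Link′ : ℕ → ℕ → ℕ → Set
  Link′ v a b = Face K′ v a b

  LinkConnected : ℕ → Set
  LinkConnected v = ∀ w w' → Edge K′ v w → Edge K′ v w' → Star (Link′ v) w w'

  linkVia : ∀ v (f : ℕ → ℕ) → (∀ a b → Face K v a b → Star (Link′ v) (f a) (f b)) →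
            (∀ w → Edge K′ v w → f w ≡ w) →
            (∀ w c → FaceT A (v , w , c) → ∃[ w₀ ] (Edge K v w₀ × Star (Link′ v) w (f w₀))) →
            LinkConnected v
  linkVia v f step fixed gained w w' e e' =
    let w₀ , e₀ , p = reach w e
        w₀' , e₀' , p' = reach w' e'
    in p ◅◅ kleisliStar {T = λ a b → Face K v a b} f (λ {a} {b} → step a b) (linkConn tK v w₀ w₀' e₀ e₀')
         ◅◅ reverse f132 p'
    where
    reach : ∀ w → Edge K′ v w → ∃[ w₀ ] (Edge K v w₀ × Star (Link′ v) w (f w₀))
    reach w (c , fc) with origin fc
    ... | inj₁ (fK , _) = w , (c , fK) , subst (Star (Link′ v) w) (sym (fixed w (c , fc))) ε
    ... | inj₂ fA = gained w c fA

  awayVertex : ∀ {v} → ¬ Touched v → LinkConnected v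
  awayVertex {v} away =
    linkVia v (λ n → n) (λ a b f → return (kept f (λ fR → away (AnyP.++⁺ˡ (Any.map first fR)))))
            (λ _ _ → refl) (λ w c fA → ⊥-elim (away (AnyP.++⁺ʳ R (Any.map first fA))))

  linkConn′ : All (OnVertices LinkConnected) (R ++ A) → ∀ v → LinkConnected v
  linkConn′ local v with any? (∈3? v) (R ++ A)
  ... | no away = awayVertex away
  ... | yes near = atSome local near onVertex

  Reaches : ℕ → Set
  Reaches a = ∃[ a₀ ] (Vertex K a₀ × Star (Edge K′) a a₀)

  bridge : All (OnEdges (Star (Edge K′))) R → ∀ {a b} → Edge K a b → Star (Edge K′) a b
  bridge paths {a} {b} (c , f) with FaceT? R (a , b , c)
  ... | no ∉R = return (c , kept f ∉R)
  ... | yes ∈R = atSome paths ∈R λ ok p →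
          onEdge ε (reverse edgeSym) ok (proj₁ (firstTwo p)) (proj₂ (firstTwo p))

  reachK : All (OnVertices Reaches) A → ∀ {a} → Vertex K′ a → Reaches a
  reachK reachA (b , c , f) with origin f
  ... | inj₁ (fK , _) = _ , (b , c , fK) , ε
  ... | inj₂ fA = atSome reachA fA λ ok p → onVertex ok (first p)

  connected′ : All (OnEdges (Star (Edge K′))) R → All (OnVertices Reaches) A →
               ∀ a b → Vertex K′ a → Vertex K′ b → Star (Edge K′) a b
  connected′ paths reachA a b va vb with reachK reachA va | reachK reachA vb
  ... | a₀ , va₀ , p | b₀ , vb₀ , q =
    p ◅◅ kleisliStar (λ n → n) (bridge paths) (connected tK a₀ b₀ va₀ vb₀) ◅◅ reverse edgeSym q

  isTriangulation′ : A ≢ [] → AllPairs (λ t t' → ¬ (t ≈T t')) A → All (λ a → ¬ FaceT K a) A →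
                     All (OnEdges EdgeOK) (R ++ A) → All (OnVertices LinkConnected) (R ++ A) →
                     All (OnEdges (Star (Edge K′))) R → All (OnVertices Reaches) A →
                     IsTriangulation K′
  isTriangulation′ A≢[] distinct new edges links paths reachA = record
    { nonempty = replace-nonempty {K} {R} {A} A≢[]
    ; nondegen = nondegen′
    ; noRepeat = replace-noRepeat (noRepeat tK) distinct new
    ; edgeInTwo = edgeInTwo′ edges
    ; linkConn = linkConn′ links
    ; connected = connected′ paths reachA
    }

module PSplit (G : Complex) (tG : IsTriangulation G) {v w x y z u' : ℕ}
              (vwx : Face G v w x) (vxy : Face G v x y) (vyz : Face G v y z)
              (w≢y : w ≢ y) (w≢z : w ≢ z) (x≢z : x ≢ z)
              (¬wz : ¬ Edge G w z) (u'∉G : ¬ Vertex G u') where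

  removed : List Tri
  removed = (v , w , x) ∷ (v , x , y) ∷ (v , y , z) ∷ []

  created : List Tri
  created = (v , w , z) ∷ (u' , w , z) ∷ (u' , w , x) ∷ (u' , x , y) ∷ (u' , y , z) ∷ []

  dvwx : Distinct3 (v , w , x)
  dvwx = faceDistinct tG vwx
  dvxy : Distinct3 (v , x , y)
  dvxy = faceDistinct tG vxy
  dvyz : Distinct3 (v , y , z)
  dvyz = faceDistinct tG vyz

  v≢w : v ≢ w
  v≢w = proj₁ dvwx
  v≢x : v ≢ x
  v≢x = proj₁ (proj₂ dvwx)
  w≢x : w ≢ x
  w≢x = proj₂ (proj₂ dvwx)
  v≢y : v ≢ y
  v≢y = proj₁ (proj₂ dvxy)
  x≢y : x ≢ y
  x≢y = proj₂ (proj₂ dvxy)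
  v≢z : v ≢ z
  v≢z = proj₁ (proj₂ dvyz)
  y≢z : y ≢ z
  y≢z = proj₂ (proj₂ dvyz)

  w≢v : w ≢ v
  w≢v = ≢-sym v≢w
  x≢v : x ≢ v
  x≢v = ≢-sym v≢x
  x≢w : x ≢ w
  x≢w = ≢-sym w≢x
  y≢v : y ≢ v
  y≢v = ≢-sym v≢y
  y≢w : y ≢ w
  y≢w = ≢-sym w≢y
  y≢x : y ≢ x
  y≢x = ≢-sym x≢y
  z≢v : z ≢ v
  z≢v = ≢-sym v≢z
  z≢w : z ≢ w
  z≢w = ≢-sym w≢z
  z≢x : z ≢ x
  z≢x = ≢-sym x≢z
  z≢y : z ≢ y
  z≢y = ≢-sym y≢z

  vertexV : Vertex G v
  vertexV = _ , _ , vwx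
  vertexW : Vertex G w
  vertexW = _ , _ , f231 vwx
  vertexX : Vertex G x
  vertexX = _ , _ , f312 vwx
  vertexY : Vertex G y
  vertexY = _ , _ , f231 vyz
  vertexZ : Vertex G z
  vertexZ = _ , _ , f312 vyz

  fresh : ∀ {a} → Vertex G a → u' ≢ a
  fresh a∈G refl = u'∉G a∈G

  u'≢v : u' ≢ v
  u'≢v = fresh vertexV
  u'≢w : u' ≢ w
  u'≢w = fresh vertexW
  u'≢x : u' ≢ x
  u'≢x = fresh vertexX
  u'≢y : u' ≢ y
  u'≢y = fresh vertexY
  u'≢z : u' ≢ z
  u'≢z = fresh vertexZ

  v≢u' : v ≢ u'
  v≢u' = ≢-sym u'≢v
  w≢u' : w ≢ u'
  w≢u' = ≢-sym u'≢w
  x≢u' : x ≢ u'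
  x≢u' = ≢-sym u'≢x
  y≢u' : y ≢ u'
  y≢u' = ≢-sym u'≢y
  z≢u' : z ≢ u'
  z≢u' = ≢-sym u'≢z

  dvwz : Distinct3 (v , w , z)
  dvwz = v≢w , v≢z , w≢z
  du'wz : Distinct3 (u' , w , z)
  du'wz = u'≢w , u'≢z , w≢z
  du'wx : Distinct3 (u' , w , x)
  du'wx = u'≢w , u'≢x , w≢x
  du'xy : Distinct3 (u' , x , y)
  du'xy = u'≢x , u'≢y , x≢y
  du'yz : Distinct3 (u' , y , z)
  du'yz = u'≢y , u'≢z , y≢z

  open Replacement G tG removed created (dvwz ∷ du'wz ∷ du'wx ∷ du'xy ∷ du'yz ∷ [])
    public using (K′; origin; kept; added; TwoFaces; EdgeOK; Link′; LinkConnected; Reaches;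
                  swappedEdge; newEdge; deletedEdge; linkVia; isTriangulation′)

  G₁ : Complex
  G₁ = K′

  createdNew : All (λ a → ¬ FaceT G a) created
  createdNew = (λ f → ¬wz (v , f231 f)) ∷ (λ f → u'∉G (_ , _ , f)) ∷ (λ f → u'∉G (_ , _ , f)) ∷
               (λ f → u'∉G (_ , _ , f)) ∷ (λ f → u'∉G (_ , _ , f)) ∷ []

  createdDistinct : AllPairs (λ t t' → ¬ (t ≈T t')) created
  createdDistinct =
    (absent₁ (∉3 u'≢v u'≢w u'≢z) ∷ absent₁ (∉3 u'≢v u'≢w u'≢z) ∷
     absent₁ (∉3 u'≢v u'≢w u'≢z) ∷ absent₁ (∉3 u'≢v u'≢w u'≢z) ∷ []) ∷
    (absent₃ (∉3 x≢u' x≢w x≢z) ∷ absent₂ (∉3 x≢u' x≢w x≢z) ∷ absent₂ (∉3 y≢u' y≢w y≢z) ∷ []) ∷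
    (absent₃ (∉3 y≢u' y≢w y≢x) ∷ absent₂ (∉3 y≢u' y≢w y≢x) ∷ []) ∷
    (absent₃ (∉3 z≢u' z≢x z≢y) ∷ []) ∷
    [] ∷ []

  -- Edges.  The edges vx and vy disappear, wz is created with the
  -- faces vwz and u'wz, the edges u'w, u'x, u'y, u'z are created, and
  -- vw, wx, xy, yz, vz each trade one face for a created one.
  createdAtV : ∀ {a b} → FaceT created (v , a , b) → (v , w , z) ≈T (v , a , b)
  createdAtV (#0 p) = p
  createdAtV (#1 p) = ⊥-elim (absent₁ (∉3 v≢u' v≢w v≢z) p)
  createdAtV (#2 p) = ⊥-elim (absent₁ (∉3 v≢u' v≢w v≢x) p)
  createdAtV (#3 p) = ⊥-elim (absent₁ (∉3 v≢u' v≢x v≢y) p)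
  createdAtV (#4 p) = ⊥-elim (absent₁ (∉3 v≢u' v≢y v≢z) p)

  removedAtVX : ∀ {b} → Face G v x b → FaceT removed (v , x , b)
  removedAtVX f with onlyFaces tG (f132 vwx) vxy w≢y f
  ... | inj₁ refl = #0 π132
  ... | inj₂ refl = #1 π123

  removedAtVY : ∀ {b} → Face G v y b → FaceT removed (v , y , b)
  removedAtVY f with onlyFaces tG (f132 vxy) vyz x≢z f
  ... | inj₁ refl = #1 π132
  ... | inj₂ refl = #2 π123

  ¬vx : ¬ Edge G₁ v x
  ¬vx = deletedEdge (λ _ → removedAtVX) λ e c → absent₂ (∉3 x≢v x≢w x≢z) (createdAtV c)

  ¬vy : ¬ Edge G₁ v y
  ¬vy = deletedEdge (λ _ → removedAtVY) λ e c → absent₂ (∉3 y≢v y≢w y≢z) (createdAtV c)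

  vw-two : TwoFaces v w
  vw-two = swappedEdge vwx (#0 π123) (#0 π123) (λ f → ¬wz (v , f231 f)) onlyR onlyC
    where
    onlyR : ∀ e → FaceT removed (v , w , e) → e ≡ x
    onlyR e (#0 p) = completes₃ dvwx p
    onlyR e (#1 p) = ⊥-elim (absent₂ (∉3 w≢v w≢x w≢y) p)
    onlyR e (#2 p) = ⊥-elim (absent₂ (∉3 w≢v w≢y w≢z) p)
    onlyC : ∀ e → FaceT created (v , w , e) → e ≡ z
    onlyC e c = completes₃ dvwz (createdAtV c)

  vz-two : TwoFaces v z
  vz-two = swappedEdge (f132 vyz) (#2 π132) (#0 π132) (λ f → ¬wz (v , f321 f)) onlyR onlyC
    where
    onlyR : ∀ e → FaceT removed (v , z , e) → e ≡ y
    onlyR e (#0 p) = ⊥-elim (absent₂ (∉3 z≢v z≢w z≢x) p)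
    onlyR e (#1 p) = ⊥-elim (absent₂ (∉3 z≢v z≢x z≢y) p)
    onlyR e (#2 p) = completes₂ dvyz p
    onlyC : ∀ e → FaceT created (v , z , e) → e ≡ w
    onlyC e c = completes₂ dvwz (createdAtV c)

  wx-two : TwoFaces w x
  wx-two = swappedEdge (f231 vwx) (#0 π231) (#2 π231) (λ f → u'∉G (_ , _ , f312 f)) onlyR onlyC
    where
    onlyR : ∀ e → FaceT removed (w , x , e) → e ≡ v
    onlyR e (#0 p) = completes₁ dvwx p
    onlyR e (#1 p) = ⊥-elim (absent₁ (∉3 w≢v w≢x w≢y) p)
    onlyR e (#2 p) = ⊥-elim (absent₁ (∉3 w≢v w≢y w≢z) p)
    onlyC : ∀ e → FaceT created (w , x , e) → e ≡ u'
    onlyC e (#0 p) = ⊥-elim (absent₂ (∉3 x≢v x≢w x≢z) p)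
    onlyC e (#1 p) = ⊥-elim (absent₂ (∉3 x≢u' x≢w x≢z) p)
    onlyC e (#2 p) = completes₁ du'wx p
    onlyC e (#3 p) = ⊥-elim (absent₁ (∉3 w≢u' w≢x w≢y) p)
    onlyC e (#4 p) = ⊥-elim (absent₁ (∉3 w≢u' w≢y w≢z) p)

  xy-two : TwoFaces x y
  xy-two = swappedEdge (f231 vxy) (#1 π231) (#3 π231) (λ f → u'∉G (_ , _ , f312 f)) onlyR onlyC
    where
    onlyR : ∀ e → FaceT removed (x , y , e) → e ≡ v
    onlyR e (#0 p) = ⊥-elim (absent₂ (∉3 y≢v y≢w y≢x) p)
    onlyR e (#1 p) = completes₁ dvxy p
    onlyR e (#2 p) = ⊥-elim (absent₁ (∉3 x≢v x≢y x≢z) p)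
    onlyC : ∀ e → FaceT created (x , y , e) → e ≡ u'
    onlyC e (#0 p) = ⊥-elim (absent₁ (∉3 x≢v x≢w x≢z) p)
    onlyC e (#1 p) = ⊥-elim (absent₁ (∉3 x≢u' x≢w x≢z) p)
    onlyC e (#2 p) = ⊥-elim (absent₂ (∉3 y≢u' y≢w y≢x) p)
    onlyC e (#3 p) = completes₁ du'xy p
    onlyC e (#4 p) = ⊥-elim (absent₁ (∉3 x≢u' x≢y x≢z) p)

  yz-two : TwoFaces y z
  yz-two = swappedEdge (f231 vyz) (#2 π231) (#4 π231) (λ f → u'∉G (_ , _ , f312 f)) onlyR onlyC
    where
    onlyR : ∀ e → FaceT removed (y , z , e) → e ≡ v
    onlyR e (#0 p) = ⊥-elim (absent₁ (∉3 y≢v y≢w y≢x) p)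
    onlyR e (#1 p) = ⊥-elim (absent₂ (∉3 z≢v z≢x z≢y) p)
    onlyR e (#2 p) = completes₁ dvyz p
    onlyC : ∀ e → FaceT created (y , z , e) → e ≡ u'
    onlyC e (#0 p) = ⊥-elim (absent₁ (∉3 y≢v y≢w y≢z) p)
    onlyC e (#1 p) = ⊥-elim (absent₁ (∉3 y≢u' y≢w y≢z) p)
    onlyC e (#2 p) = ⊥-elim (absent₁ (∉3 y≢u' y≢w y≢x) p)
    onlyC e (#3 p) = ⊥-elim (absent₂ (∉3 z≢u' z≢x z≢y) p)
    onlyC e (#4 p) = completes₁ du'yz p

  wz-two : TwoFaces w z
  wz-two = newEdge (#0 π231) (#1 π231) v≢u' ¬wz onlyC
    where
    onlyC : ∀ e → FaceT created (w , z , e) → (e ≡ v) ⊎ (e ≡ u')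
    onlyC e (#0 p) = inj₁ (completes₁ dvwz p)
    onlyC e (#1 p) = inj₂ (completes₁ du'wz p)
    onlyC e (#2 p) = ⊥-elim (absent₂ (∉3 z≢u' z≢w z≢x) p)
    onlyC e (#3 p) = ⊥-elim (absent₁ (∉3 w≢u' w≢x w≢y) p)
    onlyC e (#4 p) = ⊥-elim (absent₁ (∉3 w≢u' w≢y w≢z) p)

  ¬u'G : ∀ {a} → ¬ Edge G u' a
  ¬u'G (c , f) = u'∉G (_ , c , f)

  notVWZ : ∀ {a b} → ¬ ((v , w , z) ≈T (u' , a , b))
  notVWZ = absent₁ (∉3 u'≢v u'≢w u'≢z)

  u'w-two : TwoFaces u' w
  u'w-two = newEdge (#1 π123) (#2 π123) z≢x ¬u'G onlyC
    where
    onlyC : ∀ e → FaceT created (u' , w , e) → (e ≡ z) ⊎ (e ≡ x)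
    onlyC e (#0 p) = ⊥-elim (notVWZ p)
    onlyC e (#1 p) = inj₁ (completes₃ du'wz p)
    onlyC e (#2 p) = inj₂ (completes₃ du'wx p)
    onlyC e (#3 p) = ⊥-elim (absent₂ (∉3 w≢u' w≢x w≢y) p)
    onlyC e (#4 p) = ⊥-elim (absent₂ (∉3 w≢u' w≢y w≢z) p)

  u'x-two : TwoFaces u' x
  u'x-two = newEdge (#2 π132) (#3 π123) w≢y ¬u'G onlyC
    where
    onlyC : ∀ e → FaceT created (u' , x , e) → (e ≡ w) ⊎ (e ≡ y)
    onlyC e (#0 p) = ⊥-elim (notVWZ p)
    onlyC e (#1 p) = ⊥-elim (absent₂ (∉3 x≢u' x≢w x≢z) p)
    onlyC e (#2 p) = inj₁ (completes₂ du'wx p)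
    onlyC e (#3 p) = inj₂ (completes₃ du'xy p)
    onlyC e (#4 p) = ⊥-elim (absent₂ (∉3 x≢u' x≢y x≢z) p)

  u'y-two : TwoFaces u' y
  u'y-two = newEdge (#3 π132) (#4 π123) x≢z ¬u'G onlyC
    where
    onlyC : ∀ e → FaceT created (u' , y , e) → (e ≡ x) ⊎ (e ≡ z)
    onlyC e (#0 p) = ⊥-elim (notVWZ p)
    onlyC e (#1 p) = ⊥-elim (absent₂ (∉3 y≢u' y≢w y≢z) p)
    onlyC e (#2 p) = ⊥-elim (absent₂ (∉3 y≢u' y≢w y≢x) p)
    onlyC e (#3 p) = inj₁ (completes₂ du'xy p)
    onlyC e (#4 p) = inj₂ (completes₃ du'yz p)

  u'z-two : TwoFaces u' z
  u'z-two = newEdge (#1 π132) (#4 π132) w≢y ¬u'G onlyC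
    where
    onlyC : ∀ e → FaceT created (u' , z , e) → (e ≡ w) ⊎ (e ≡ y)
    onlyC e (#0 p) = ⊥-elim (notVWZ p)
    onlyC e (#1 p) = inj₁ (completes₂ du'wz p)
    onlyC e (#2 p) = ⊥-elim (absent₂ (∉3 z≢u' z≢w z≢x) p)
    onlyC e (#3 p) = ⊥-elim (absent₂ (∉3 z≢u' z≢x z≢y) p)
    onlyC e (#4 p) = inj₂ (completes₂ du'yz p)

  edgesOK : All (OnEdges EdgeOK) (removed ++ created)
  edgesOK =
    (ok vw-two , ok wx-two , gone ¬vx) ∷ (gone ¬vx , ok xy-two , gone ¬vy) ∷
    (gone ¬vy , ok yz-two , ok vz-two) ∷ (ok vw-two , ok wz-two , ok vz-two) ∷
    (ok u'w-two , ok wz-two , ok u'z-two) ∷ (ok u'w-two , ok wx-two , ok u'x-two) ∷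
    (ok u'x-two , ok xy-two , ok u'y-two) ∷ (ok u'y-two , ok yz-two , ok u'z-two) ∷ []
    where
    ok : ∀ {a b} → TwoFaces a b → EdgeOK a b
    ok two _ = two
    gone : ∀ {a b} → ¬ Edge G₁ a b → EdgeOK a b
    gone ¬ab ab = ⊥-elim (¬ab ab)

  along : ∀ {c a b a' b'} → a' ≡ a → b' ≡ b → Star (Link′ c) a b → Star (Link′ c) a' b'
  along refl refl path = path

  -- The link of v loses x and y: relabel x ↦ w and y ↦ z.
  atV : ℕ → ℕ
  atV n = redirect x w (redirect y z n)

  atV-x : atV x ≡ w
  atV-x = trans (cong (redirect x w) (redirect-miss x≢y)) (redirect-hit x w)

  atV-y : atV y ≡ z
  atV-y = trans (cong (redirect x w) (redirect-hit y z)) (redirect-miss z≢x)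

  atV-other : ∀ {n} → n ≢ x → n ≢ y → atV n ≡ n
  atV-other n≢x n≢y = trans (cong (redirect x w) (redirect-miss n≢y)) (redirect-miss n≢x)

  atV-kept : ∀ {a b} → Face G v a b → ¬ FaceT removed (v , a , b) → atV a ≡ a
  atV-kept f ∉R = atV-other (λ { refl → ∉R (removedAtVX f) }) (λ { refl → ∉R (removedAtVY f) })

  linkV : LinkConnected v
  linkV = linkVia v atV step (λ _ e → atV-other (λ { refl → ¬vx e }) (λ { refl → ¬vy e })) gained
    where
    step : ∀ a b → Face G v a b → Star (Link′ v) (atV a) (atV b)
    step a b f with FaceT? removed (v , a , b)
    ... | no ∉R = along (atV-kept f ∉R) (atV-kept (f132 f) (λ r → ∉R (FaceT-≈ π132 r)))
                        (return (kept f ∉R))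
    ... | yes (#0 p) with orient₁ dvwx p
    ...   | inj₁ (refl , refl) = along (atV-other w≢x w≢y) atV-x ε
    ...   | inj₂ (refl , refl) = along atV-x (atV-other w≢x w≢y) ε
    step a b f | yes (#1 p) with orient₁ dvxy p
    ...   | inj₁ (refl , refl) = along atV-x atV-y (return (added (#0 π123)))
    ...   | inj₂ (refl , refl) = along atV-y atV-x (return (added (#0 π132)))
    step a b f | yes (#2 p) with orient₁ dvyz p
    ...   | inj₁ (refl , refl) = along atV-y (atV-other z≢x z≢y) ε
    ...   | inj₂ (refl , refl) = along (atV-other z≢x z≢y) atV-y ε
    gained : ∀ a c → FaceT created (v , a , c) → ∃[ a₀ ] (Edge G v a₀ × Star (Link′ v) a (atV a₀))
    gained a c fc with orient₁ dvwz (createdAtV fc)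
    ... | inj₁ (refl , refl) = w , (x , vwx) , along refl (atV-other w≢x w≢y) ε
    ... | inj₂ (refl , refl) = z , (y , f132 vyz) , along refl (atV-other z≢x z≢y) ε

  -- Around w the removed face vwx becomes the fan x u' z v.
  linkW : LinkConnected w
  linkW = linkVia w (λ n → n) step (λ _ _ → refl) gained
    where
    xu' : Link′ w x u'
    xu' = added (#2 π231)
    u'z : Link′ w u' z
    u'z = added (#1 π213)
    zv : Link′ w z v
    zv = added (#0 π231)
    wx : Edge G w x
    wx = v , f231 vwx
    step : ∀ a b → Face G w a b → Star (Link′ w) a b
    step a b f with FaceT? removed (w , a , b)
    ... | no ∉R = return (kept f ∉R)
    ... | yes (#1 p) = ⊥-elim (absent₁ (∉3 w≢v w≢x w≢y) p)
    ... | yes (#2 p) = ⊥-elim (absent₁ (∉3 w≢v w≢y w≢z) p)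
    ... | yes (#0 p) with orient₂ dvwx p
    ...   | inj₁ (refl , refl) = f132 zv ◅ f132 u'z ◅ f132 xu' ◅ ε
    ...   | inj₂ (refl , refl) = xu' ◅ u'z ◅ zv ◅ ε
    gained : ∀ a c → FaceT created (w , a , c) → ∃[ a₀ ] (Edge G w a₀ × Star (Link′ w) a a₀)
    gained a c (#0 p) with orient₂ dvwz p
    ... | inj₁ (refl , refl) = v , (x , f213 vwx) , ε
    ... | inj₂ (refl , refl) = x , wx , f132 u'z ◅ f132 xu' ◅ ε
    gained a c (#1 p) with orient₂ du'wz p
    ... | inj₁ (refl , refl) = x , wx , f132 xu' ◅ ε
    ... | inj₂ (refl , refl) = x , wx , f132 u'z ◅ f132 xu' ◅ ε
    gained a c (#2 p) with orient₂ du'wx p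
    ... | inj₁ (refl , refl) = x , wx , f132 xu' ◅ ε
    ... | inj₂ (refl , refl) = x , wx , ε
    gained a c (#3 p) = ⊥-elim (absent₁ (∉3 w≢u' w≢x w≢y) p)
    gained a c (#4 p) = ⊥-elim (absent₁ (∉3 w≢u' w≢y w≢z) p)

  -- In the links of x and y the vertex v is replaced by u'.
  atU' : ℕ → ℕ
  atU' = redirect v u'

  linkX : LinkConnected x
  linkX = linkVia x atU' step (λ _ e → redirect-miss λ { refl → ¬vx (edgeSym e) }) gained
    where
    step : ∀ a b → Face G x a b → Star (Link′ x) (atU' a) (atU' b)
    step a b f with FaceT? removed (x , a , b)
    ... | no ∉R = along (redirect-miss (notV f ∉R)) (redirect-miss (notV (f132 f) (λ r → ∉R (FaceT-≈ π132 r))))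
                        (return (kept f ∉R))
      where
      notV : ∀ {a b} → Face G x a b → ¬ FaceT removed (x , a , b) → a ≢ v
      notV f ∉R refl = ∉R (FaceT-≈ π213 (removedAtVX (f213 f)))
    ... | yes (#2 p) = ⊥-elim (absent₁ (∉3 x≢v x≢y x≢z) p)
    ... | yes (#0 p) with orient₃ dvwx p
    ...   | inj₁ (refl , refl) = along (redirect-hit v u') (redirect-miss w≢v) (return (added (#2 π312)))
    ...   | inj₂ (refl , refl) = along (redirect-miss w≢v) (redirect-hit v u') (return (added (#2 π321)))
    step a b f | yes (#1 p) with orient₂ dvxy p
    ...   | inj₁ (refl , refl) = along (redirect-hit v u') (redirect-miss y≢v) (return (added (#3 π213)))
    ...   | inj₂ (refl , refl) = along (redirect-miss y≢v) (redirect-hit v u') (return (added (#3 π231)))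
    gained : ∀ a c → FaceT created (x , a , c) → ∃[ a₀ ] (Edge G x a₀ × Star (Link′ x) a (atU' a₀))
    gained a c (#0 p) = ⊥-elim (absent₁ (∉3 x≢v x≢w x≢z) p)
    gained a c (#1 p) = ⊥-elim (absent₁ (∉3 x≢u' x≢w x≢z) p)
    gained a c (#2 p) with orient₃ du'wx p
    ... | inj₁ (refl , refl) = v , (w , f312 vwx) , along refl (redirect-hit v u') ε
    ... | inj₂ (refl , refl) = w , (v , f321 vwx) , along refl (redirect-miss w≢v) ε
    gained a c (#3 p) with orient₂ du'xy p
    ... | inj₁ (refl , refl) = v , (w , f312 vwx) , along refl (redirect-hit v u') ε
    ... | inj₂ (refl , refl) = y , (v , f231 vxy) , along refl (redirect-miss y≢v) ε
    gained a c (#4 p) = ⊥-elim (absent₁ (∉3 x≢u' x≢y x≢z) p)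

  linkY : LinkConnected y
  linkY = linkVia y atU' step (λ _ e → redirect-miss λ { refl → ¬vy (edgeSym e) }) gained
    where
    step : ∀ a b → Face G y a b → Star (Link′ y) (atU' a) (atU' b)
    step a b f with FaceT? removed (y , a , b)
    ... | no ∉R = along (redirect-miss (notV f ∉R)) (redirect-miss (notV (f132 f) (λ r → ∉R (FaceT-≈ π132 r))))
                        (return (kept f ∉R))
      where
      notV : ∀ {a b} → Face G y a b → ¬ FaceT removed (y , a , b) → a ≢ v
      notV f ∉R refl = ∉R (FaceT-≈ π213 (removedAtVY (f213 f)))
    ... | yes (#0 p) = ⊥-elim (absent₁ (∉3 y≢v y≢w y≢x) p)
    ... | yes (#1 p) with orient₃ dvxy p
    ...   | inj₁ (refl , refl) = along (redirect-hit v u') (redirect-miss x≢v) (return (added (#3 π312)))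
    ...   | inj₂ (refl , refl) = along (redirect-miss x≢v) (redirect-hit v u') (return (added (#3 π321)))
    step a b f | yes (#2 p) with orient₂ dvyz p
    ...   | inj₁ (refl , refl) = along (redirect-hit v u') (redirect-miss z≢v) (return (added (#4 π213)))
    ...   | inj₂ (refl , refl) = along (redirect-miss z≢v) (redirect-hit v u') (return (added (#4 π231)))
    gained : ∀ a c → FaceT created (y , a , c) → ∃[ a₀ ] (Edge G y a₀ × Star (Link′ y) a (atU' a₀))
    gained a c (#0 p) = ⊥-elim (absent₁ (∉3 y≢v y≢w y≢z) p)
    gained a c (#1 p) = ⊥-elim (absent₁ (∉3 y≢u' y≢w y≢z) p)
    gained a c (#2 p) = ⊥-elim (absent₁ (∉3 y≢u' y≢w y≢x) p)
    gained a c (#3 p) with orient₃ du'xy p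
    ... | inj₁ (refl , refl) = v , (x , f312 vxy) , along refl (redirect-hit v u') ε
    ... | inj₂ (refl , refl) = x , (v , f321 vxy) , along refl (redirect-miss x≢v) ε
    gained a c (#4 p) with orient₂ du'yz p
    ... | inj₁ (refl , refl) = v , (x , f312 vxy) , along refl (redirect-hit v u') ε
    ... | inj₂ (refl , refl) = z , (v , f231 vyz) , along refl (redirect-miss z≢v) ε

  -- Around z the removed face vyz becomes the fan v w u' y.
  linkZ : LinkConnected z
  linkZ = linkVia z (λ n → n) step (λ _ _ → refl) gained
    where
    vw : Link′ z v w
    vw = added (#0 π312)
    wu' : Link′ z w u'
    wu' = added (#1 π321)
    u'y : Link′ z u' y
    u'y = added (#4 π312)
    zv : Edge G z v
    zv = y , f312 vyz
    step : ∀ a b → Face G z a b → Star (Link′ z) a b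
    step a b f with FaceT? removed (z , a , b)
    ... | no ∉R = return (kept f ∉R)
    ... | yes (#0 p) = ⊥-elim (absent₁ (∉3 z≢v z≢w z≢x) p)
    ... | yes (#1 p) = ⊥-elim (absent₁ (∉3 z≢v z≢x z≢y) p)
    ... | yes (#2 p) with orient₃ dvyz p
    ...   | inj₁ (refl , refl) = vw ◅ wu' ◅ u'y ◅ ε
    ...   | inj₂ (refl , refl) = f132 u'y ◅ f132 wu' ◅ f132 vw ◅ ε
    gained : ∀ a c → FaceT created (z , a , c) → ∃[ a₀ ] (Edge G z a₀ × Star (Link′ z) a a₀)
    gained a c (#0 p) with orient₃ dvwz p
    ... | inj₁ (refl , refl) = v , zv , ε
    ... | inj₂ (refl , refl) = v , zv , f132 vw ◅ ε
    gained a c (#1 p) with orient₃ du'wz p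
    ... | inj₁ (refl , refl) = v , zv , f132 wu' ◅ f132 vw ◅ ε
    ... | inj₂ (refl , refl) = v , zv , f132 vw ◅ ε
    gained a c (#2 p) = ⊥-elim (absent₁ (∉3 z≢u' z≢w z≢x) p)
    gained a c (#3 p) = ⊥-elim (absent₁ (∉3 z≢u' z≢x z≢y) p)
    gained a c (#4 p) with orient₃ du'yz p
    ... | inj₁ (refl , refl) = v , zv , f132 wu' ◅ f132 vw ◅ ε
    ... | inj₂ (refl , refl) = y , (v , f321 vyz) , ε

  -- The link of the new vertex u' is the path w x y z closed up by wz:
  -- every neighbour of u' is linked to w.
  linkU' : LinkConnected u'
  linkU' a b ea eb = toW ea ◅◅ reverse f132 (toW eb)
    where
    xw : Link′ u' x w
    xw = added (#2 π132)
    yx : Link′ u' y x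
    yx = added (#3 π132)
    zw : Link′ u' z w
    zw = added (#1 π132)
    toW : ∀ {a} → Edge G₁ u' a → Star (Link′ u') a w
    toW (c , f) with origin f
    ... | inj₁ (fG , _) = ⊥-elim (u'∉G (_ , _ , fG))
    ... | inj₂ (#0 p) = ⊥-elim (notVWZ p)
    ... | inj₂ (#1 p) with orient₁ du'wz p
    ...   | inj₁ (refl , refl) = ε
    ...   | inj₂ (refl , refl) = zw ◅ ε
    toW (c , f) | inj₂ (#2 p) with orient₁ du'wx p
    ...   | inj₁ (refl , refl) = ε
    ...   | inj₂ (refl , refl) = xw ◅ ε
    toW (c , f) | inj₂ (#3 p) with orient₁ du'xy p
    ...   | inj₁ (refl , refl) = xw ◅ ε
    ...   | inj₂ (refl , refl) = yx ◅ xw ◅ ε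
    toW (c , f) | inj₂ (#4 p) with orient₁ du'yz p
    ...   | inj₁ (refl , refl) = yx ◅ xw ◅ ε
    ...   | inj₂ (refl , refl) = zw ◅ ε

  linksOK : All (OnVertices LinkConnected) (removed ++ created)
  linksOK = (linkV , linkW , linkX) ∷ (linkV , linkX , linkY) ∷ (linkV , linkY , linkZ) ∷
            (linkV , linkW , linkZ) ∷ (linkU' , linkW , linkZ) ∷ (linkU' , linkW , linkX) ∷
            (linkU' , linkX , linkY) ∷ (linkU' , linkY , linkZ) ∷ []

  pathsOK : All (OnEdges (Star (Edge G₁))) removed
  pathsOK = (return vw , return wx , vw ◅ wx ◅ ε) ∷
            (vw ◅ wx ◅ ε , return xy , vz ◅ edgeSym yz ◅ ε) ∷
            (vz ◅ edgeSym yz ◅ ε , return yz , return vz) ∷ []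
    where
    vw : Edge G₁ v w
    vw = z , added (#0 π123)
    vz : Edge G₁ v z
    vz = w , added (#0 π132)
    wx : Edge G₁ w x
    wx = u' , added (#2 π231)
    xy : Edge G₁ x y
    xy = u' , added (#3 π231)
    yz : Edge G₁ y z
    yz = u' , added (#4 π231)

  reachOK : All (OnVertices Reaches) created
  reachOK = (inG vertexV , inG vertexW , inG vertexZ) ∷ (u'w , inG vertexW , inG vertexZ) ∷
            (u'w , inG vertexW , inG vertexX) ∷ (u'w , inG vertexX , inG vertexY) ∷
            (u'w , inG vertexY , inG vertexZ) ∷ []
    where
    inG : ∀ {a} → Vertex G a → Reaches a
    inG a∈G = _ , a∈G , ε
    u'w : Reaches u'
    u'w = w , vertexW , return (z , added (#1 π123))

  isTriangulation₁ : IsTriangulation G₁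
  isTriangulation₁ =
    isTriangulation′ (λ ()) createdDistinct createdNew edgesOK linksOK pathsOK reachOK

  pSplitting : PSplitting G G₁
  pSplitting = v , w , x , y , z , u' , vwx , vxy , vyz , w≢x , w≢y , w≢z , x≢y , x≢z , y≢z ,
               ¬wz , u'∉G , replaces , isTriangulation₁

module BESubdivisionAsPSplittings
  (G G' : Complex) (tG : IsTriangulation G) (tG' : IsTriangulation G')
  {v₀ v₁ x y p q u : ℕ} (x≢y : x ≢ y) (xv₀v₁ : Face G x v₀ v₁) (yv₀v₁ : Face G y v₀ v₁)
  (p∉G : ¬ Vertex G p) (q∉G : ¬ Vertex G q) (p≢q : p ≢ q)
  (be : Replaces G ((x , v₀ , v₁) ∷ (y , v₀ , v₁) ∷ [])
                   ((x , v₀ , q) ∷ (x , p , q) ∷ (x , p , v₁) ∷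
                    (y , v₀ , q) ∷ (y , p , q) ∷ (y , p , v₁) ∷ []) G')
  (uxv₁ : Face G u x v₁) (u≢v₀ : u ≢ v₀) (u≢y : u ≢ y) (¬uy : ¬ Edge G u y) where

  -- The first splitting; in S the roles v, w, x, y, z, u' are played by
  -- v₁, u, x, v₀, y, q.
  module S = PSplit G tG (f312 uxv₁) (f312 xv₀v₁) (f321 yv₀v₁) u≢v₀ u≢y x≢y ¬uy q∉G
  open S using (G₁; origin; added)

  removed₂ : List Tri
  removed₂ = (u , v₁ , y) ∷ (u , y , q) ∷ (u , q , x) ∷ []

  created₂ : List Tri
  created₂ = (u , v₁ , x) ∷ (p , v₁ , x) ∷ (p , v₁ , y) ∷ (p , y , q) ∷ (p , q , x) ∷ []

  -- The vertices of G₁ are those of G and q, so p is new in G₁.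
  pFresh : ∀ {a} → Vertex G a → p ≢ a
  pFresh a∈G refl = p∉G a∈G

  p∉G₁ : ¬ Vertex G₁ p
  p∉G₁ p∈G₁ with replacedVertex {G} {S.removed} {S.created} p∈G₁
  ... | inj₁ p∈G = p∉G p∈G
  ... | inj₂ (#0 m) = ∉3 (pFresh S.vertexV) (pFresh S.vertexW) (pFresh S.vertexZ) m
  ... | inj₂ (#1 m) = ∉3 p≢q (pFresh S.vertexW) (pFresh S.vertexZ) m
  ... | inj₂ (#2 m) = ∉3 p≢q (pFresh S.vertexW) (pFresh S.vertexX) m
  ... | inj₂ (#3 m) = ∉3 p≢q (pFresh S.vertexX) (pFresh S.vertexY) m
  ... | inj₂ (#4 m) = ∉3 p≢q (pFresh S.vertexY) (pFresh S.vertexZ) m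

  removed₂∉G : ∀ {t} → FaceT G t → ¬ FaceT removed₂ t
  removed₂∉G f (#0 r) = ¬uy (v₁ , f132 (FaceT-≈ (≈-sym r) f))
  removed₂∉G f (#1 r) = q∉G (u , y , f312 (FaceT-≈ (≈-sym r) f))
  removed₂∉G f (#2 r) = q∉G (u , x , f213 (FaceT-≈ (≈-sym r) f))

  v₀∉removed₂ : ∀ {a c t} → (a , v₀ , c) ≈T t → ¬ FaceT removed₂ t
  v₀∉removed₂ e (#0 r) = absent₂ (∉3 S.y≢w S.y≢v S.y≢z) (≈-trans r (≈-sym e))
  v₀∉removed₂ e (#1 r) = absent₂ (∉3 S.y≢w S.y≢z S.y≢u') (≈-trans r (≈-sym e))
  v₀∉removed₂ e (#2 r) = absent₂ (∉3 S.y≢w S.y≢u' S.y≢x) (≈-trans r (≈-sym e))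

  secondReplaces : Replaces G₁ removed₂ created₂ G'
  secondReplaces t = mk⇔ toSecond fromSecond
    where
    toSecond : FaceT G' t → (FaceT G₁ t × ¬ FaceT removed₂ t) ⊎ FaceT created₂ t
    toSecond f with Equivalence.to (be t) f
    ... | inj₂ (#0 e) = inj₁ (added (#3 (≈-trans π231 e)) , v₀∉removed₂ e)
    ... | inj₂ (#1 e) = inj₂ (#4 (≈-trans π312 e))
    ... | inj₂ (#2 e) = inj₂ (#1 (≈-trans π312 e))
    ... | inj₂ (#3 e) = inj₁ (added (#4 (≈-trans π321 e)) , v₀∉removed₂ e)
    ... | inj₂ (#4 e) = inj₂ (#3 (≈-trans π213 e))
    ... | inj₂ (#5 e) = inj₂ (#2 (≈-trans π312 e))
    ... | inj₁ (fG , ∉be) with FaceT? S.removed t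
    ...   | no ∉R = inj₁ (S.kept fG ∉R , removed₂∉G fG)
    ...   | yes (#0 e) = inj₂ (#0 (≈-trans π213 e))
    ...   | yes (#1 e) = ⊥-elim (∉be (#0 (≈-trans π312 e)))
    ...   | yes (#2 e) = ⊥-elim (∉be (#1 (≈-trans π321 e)))
    fromSecond : (FaceT G₁ t × ¬ FaceT removed₂ t) ⊎ FaceT created₂ t → FaceT G' t
    fromSecond h = Equivalence.from (be t) (viaG h)
      where
      viaG : (FaceT G₁ t × ¬ FaceT removed₂ t) ⊎ FaceT created₂ t →
             (FaceT G t × ¬ FaceT ((x , v₀ , v₁) ∷ (y , v₀ , v₁) ∷ []) t) ⊎
             FaceT ((x , v₀ , q) ∷ (x , p , q) ∷ (x , p , v₁) ∷
                    (y , v₀ , q) ∷ (y , p , q) ∷ (y , p , v₁) ∷ []) t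
      viaG (inj₂ (#0 e)) = inj₁ (FaceT-≈ (≈-trans π132 e) uxv₁ , ∉be)
        where
        ∉be : ¬ FaceT ((x , v₀ , v₁) ∷ (y , v₀ , v₁) ∷ []) t
        ∉be (#0 r) = absent₁ (∉3 S.w≢x u≢v₀ S.w≢v) (≈-trans r (≈-sym e))
        ∉be (#1 r) = absent₁ (∉3 u≢y u≢v₀ S.w≢v) (≈-trans r (≈-sym e))
      viaG (inj₂ (#1 e)) = inj₂ (#2 (≈-trans π231 e))
      viaG (inj₂ (#2 e)) = inj₂ (#5 (≈-trans π231 e))
      viaG (inj₂ (#3 e)) = inj₂ (#4 (≈-trans π213 e))
      viaG (inj₂ (#4 e)) = inj₂ (#1 (≈-trans π231 e))
      viaG (inj₁ (f₁ , ∉R₂)) with origin f₁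
      ... | inj₁ (fG , ∉R) = inj₁ (fG , ∉be)
        where
        ∉be : ¬ FaceT ((x , v₀ , v₁) ∷ (y , v₀ , v₁) ∷ []) t
        ∉be (#0 r) = ∉R (#1 (≈-trans π231 r))
        ∉be (#1 r) = ∉R (#2 (≈-trans π321 r))
      ... | inj₂ (#0 e) = ⊥-elim (∉R₂ (#0 (≈-trans π213 e)))
      ... | inj₂ (#1 e) = ⊥-elim (∉R₂ (#1 (≈-trans π312 e)))
      ... | inj₂ (#2 e) = ⊥-elim (∉R₂ (#2 (≈-trans π213 e)))
      ... | inj₂ (#3 e) = inj₂ (#0 (≈-trans π312 e))
      ... | inj₂ (#4 e) = inj₂ (#3 (≈-trans π321 e))

  secondSplitting : PSplitting G₁ G'
  secondSplitting =
    u , v₁ , y , q , x , p , added (#0 π213) , added (#1 π231) , added (#2 π213) ,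
    S.v≢z , S.v≢u' , S.v≢x , S.z≢u' , S.z≢x , S.u'≢x , S.¬vx , p∉G₁ , secondReplaces , tG'

  pSplittings : PSplittings G G'
  pSplittings = S.pSplitting ◅ secondSplitting ◅ ε

-- Lemma 4.2.  Balancedness enters only to rule out u = y: then x, v₀,
-- v₁ and u would be pairwise adjacent, a K₄ in a 3-colourable graph.
lemma4p2 : (G G' : Complex) →
    IsTriangulation G → Balanced G →
    IsTriangulation G' → Balanced G' →
    (v₀ v₁ x y p q u : ℕ) →
    BESubdivision G v₀ v₁ x y p q G' →
    Face G u x v₁ → u ≢ v₀ →
    ¬ Edge G u y →
    PSplittings G G'
lemma4p2 G G' tG balanced tG' _ v₀ v₁ x y p q u
         (x≢y , xv₀v₁ , yv₀v₁ , p∉G , q∉G , p≢q , be) uxv₁ u≢v₀ ¬uy =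
  BESubdivisionAsPSplittings.pSplittings
    G G' tG tG' x≢y xv₀v₁ yv₀v₁ p∉G q∉G p≢q be uxv₁ u≢v₀ u≢y ¬uy
  where
  u≢y : u ≢ y
  u≢y refl = noK₄ balanced (v₁ , xv₀v₁) (v₀ , f132 xv₀v₁) (v₁ , f213 uxv₁)
                           (x , f231 xv₀v₁) (v₁ , f213 yv₀v₁) (v₀ , f312 yv₀v₁)
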